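{- Let $k\ge2$ and let $n_1,n_2$ be positive integers with $\gcd(n_1,n_2)=1$. Suppose $[a_0,\dots,a_{k-1}]$ and $[b_0,\dots,b_{k-1}]$ are algebraic $k$-gons modulo $n_1$ and $n_2$ respectively, with monodromy groups $N_1\rtimes C_k$ and $N_2\rtimes C_k$. Then there exists an algebraic $k$-gon $[c_0,\dots,c_{k-1}]$ modulo $n_1n_2$ with monodromy group $(N_1\times N_2)\rtimes C_k$. Furthermore, if for every $i$ we have $a_i\not\equiv0\pmod{n_1}$ or $b_i\not\equiv0\pmod{n_2}$, then $c_i\not\equiv0\pmod{n_1n_2}$ for all $i$.
   Context: An algebraic $k$-gon modulo $n$ ($k\ge2$) is a $k$-tuple of nonnegative integers $[a_0,\dots,a_{k-1}]$ with $\sum a_i\equiv0\pmod n$ and $\gcd(a_0,\dots,a_{k-1},n)=1$. Its monodromy group is $N\rtimes C_k$, where $N\subseteq(\mathbb{Z}/n\mathbb{Z})^k$ is the additive subgroup generated by the columns of the circulant matrix with $(i,j)$ entry $a_{(i-j)\bmod k}$, and $C_k$ acts on $N$ by cyclic permutation of coordinates. Writing the monodromy group as $A\rtimes C_k$ for an abelian group $A$ means $N\cong A$. -}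

module Defs where

open import Data.Nat using (ℕ; _+_; _*_; _∸_; _%_; ∣_-_∣; NonZero)
open import Data.Nat.DivMod using (m%n<n)
open import Data.Nat.Divisibility using (_∣_)
open import Data.Nat.GCD using (gcd)
open import Data.Fin using (Fin; toℕ; fromℕ<)
open import Data.List using (map; foldr; allFin)
open import Data.Nat.ListAction using (sum)
open import Data.Product using (Σ; ∃; _×_; _,_; proj₁; proj₂)
open import Relation.Binary.PropositionalEquality using (_≡_)

Tuple : ℕ → Set
Tuple k = Fin k → ℕ

ΣFin : ∀ k → (Fin k → ℕ) → ℕ
ΣFin k f = sum (map f (allFin k))

_≡_[mod_] : ℕ → ℕ → ℕ → Set
x ≡ y [mod n ] = n ∣ ∣ x - y ∣

gcdAll : ∀ k → Tuple k → ℕ → ℕ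
gcdAll k a n = foldr gcd n (map a (allFin k))

IsAlgebraicGon : (k n : ℕ) → Tuple k → Set
IsAlgebraicGon k n a = (ΣFin k a ≡ 0 [mod n ]) × (gcdAll k a n ≡ 1)

subMod : ∀ {k} .{{_ : NonZero k}} → Fin k → Fin k → Fin k
subMod {k} i j = fromℕ< (m%n<n (toℕ i + (k ∸ toℕ j)) k)

circ : ∀ {k} .{{_ : NonZero k}} → Tuple k → Fin k → Fin k → ℕ
circ a i j = a (subMod i j)

-- (Z/nZ)^k, presented as ℕ^k up to coordinatewise congruence mod n,
-- with a subset (given by a predicate), addition and equality.
record SubAb : Set₁ where
  field
    Carrier : Set
    Mem     : Carrier → Set
    _≈_     : Carrier → Carrier → Set
    _⊕_     : Carrier → Carrier → Carrier

-- The additive subgroup N ⊆ (Z/nZ)^k generated by the columns of the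
-- circulant matrix of a: v ∈ N iff v ≡ Σ_j λ_j · (column j) (mod n)
-- for some coefficients λ_j (nonnegative suffices since the group is finite).
InN : (k n : ℕ) .{{_ : NonZero k}} → Tuple k → Tuple k → Set
InN k n a v = ∃ λ (λs : Fin k → ℕ) →
  ∀ i → v i ≡ ΣFin k (λ j → λs j * circ a i j) [mod n ]

Nsub : (k n : ℕ) .{{_ : NonZero k}} → Tuple k → SubAb
Nsub k n a = record
  { Carrier = Tuple k
  ; Mem     = InN k n a
  ; _≈_     = λ v w → ∀ i → v i ≡ w i [mod n ]
  ; _⊕_     = λ v w i → v i + w i
  }

_⊗_ : SubAb → SubAb → SubAb
G ⊗ H = record
  { Carrier = G.Carrier × H.Carrier
  ; Mem     = λ p → G.Mem (proj₁ p) × H.Mem (proj₂ p)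
  ; _≈_     = λ p q → G._≈_ (proj₁ p) (proj₁ q) × H._≈_ (proj₂ p) (proj₂ q)
  ; _⊕_     = λ p q → G._⊕_ (proj₁ p) (proj₁ q) , H._⊕_ (proj₂ p) (proj₂ q)
  }
  where
    module G = SubAb G
    module H = SubAb H

record _≅_ (G H : SubAb) : Set where
  private
    module G = SubAb G
    module H = SubAb H
  field
    to       : G.Carrier → H.Carrier
    from     : H.Carrier → G.Carrier
    to-mem   : ∀ x → G.Mem x → H.Mem (to x)
    from-mem : ∀ y → H.Mem y → G.Mem (from y)
    to-cong  : ∀ x x' → G.Mem x → G.Mem x' → G._≈_ x x' → H._≈_ (to x) (to x')
    from-cong : ∀ y y' → H.Mem y → H.Mem y' → H._≈_ y y' → G._≈_ (from y) (from y')
    from-to  : ∀ x → G.Mem x → G._≈_ (from (to x)) x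
    to-from  : ∀ y → H.Mem y → H._≈_ (to (from y)) y
    to-hom   : ∀ x x' → G.Mem x → G.Mem x' → H._≈_ (to (G._⊕_ x x')) (H._⊕_ (to x) (to x'))

module Submission where

open import Defs
open import Data.Nat using (ℕ; _*_; _≤_; NonZero)
open import Data.Nat.Coprimality using (Coprime)
open import Data.Product using (∃; _×_)
open import Data.Sum using (_⊎_)
open import Relation.Nullary using (¬_)

open import Data.Nat using (suc; _+_; _∸_; _%_; _/_; ∣_-_∣; >-nonZero)
open import Data.Nat.Properties
open import Data.Nat.DivMod
open import Data.Nat.Divisibility
open import Data.Nat.GCD using (gcd; gcd[m,n]∣m; gcd[m,n]∣n; gcd-greatest; module Bézout)
open import Data.Nat.Coprimality using (coprime-divisor; coprime-Bézout; gcd≡1⇒coprime)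
  renaming (sym to coprime-sym)
open import Data.Nat.ListAction using (sum)
open import Data.List using (List; []; _∷_; map; foldr; allFin)
open import Data.List.Relation.Unary.Any using (here; there)
open import Data.List.Membership.Propositional using (_∈_)
open import Data.List.Membership.Propositional.Properties using (∈-allFin; ∈-map⁺; ∈-map⁻)
open import Data.Product using (_,_; proj₁; proj₂)
open import Data.Sum using (inj₁; inj₂)
open import Data.Vec.Functional using (zipWith)
open import Relation.Binary.PropositionalEquality

-- Choose c with c_i ≡ a_i (mod n₁) and c_i ≡ b_i (mod n₂) by the Chinese remainder
-- theorem. Since ℤ/n₁n₂ ≅ ℤ/n₁ × ℤ/n₂ as rings, reducing a combination of the
-- columns of circ(c) gives the combinations of the columns of circ(a) and circ(b)
-- with the reduced coefficients, and conversely coefficients for a and b lift by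
-- CRT to coefficients for c; so v ↦ (v mod n₁, v mod n₂) maps N(c) onto N(a) × N(b)
-- and is injective. The sum condition, the gcd condition and the non-vanishing of
-- the c_i can likewise be checked modulo n₁ and n₂ separately.

-- Congruences are manipulated as equalities of remainders x % n ≡ y % n, to which the
-- ≡-toolkit applies; in the form n ∣ ∣ x - y ∣ the unifier cannot even recover x and y.

≡[mod]-refl : ∀ {x n} → x ≡ x [mod n ]
≡[mod]-refl {x} {n} = subst (n ∣_) (sym (∣n-n∣≡0 x)) (n ∣0)

%≡⇒≡[mod] : ∀ {x y n} .{{_ : NonZero n}} → x % n ≡ y % n → x ≡ y [mod n ]
%≡⇒≡[mod] {x} {y} {n} eq = divides ∣ x / n - y / n ∣ (begin
  ∣ x - y ∣                                     ≡⟨ cong₂ ∣_-_∣ (m≡m%n+[m/n]*n x n) (m≡m%n+[m/n]*n y n) ⟩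
  ∣ x % n + x / n * n - y % n + y / n * n ∣     ≡⟨ cong (λ r → ∣ x % n + x / n * n - r + y / n * n ∣) eq ⟨
  ∣ x % n + x / n * n - x % n + y / n * n ∣     ≡⟨ ∣m+n-m+o∣≡∣n-o∣ (x % n) _ _ ⟩
  ∣ x / n * n - y / n * n ∣                     ≡⟨ *-distribʳ-∣-∣ n (x / n) (y / n) ⟨
  ∣ x / n - y / n ∣ * n                         ∎)
  where open ≡-Reasoning

≤∧≡[mod]⇒%≡ : ∀ {x y n} .{{_ : NonZero n}} → x ≤ y → x ≡ y [mod n ] → x % n ≡ y % n
≤∧≡[mod]⇒%≡ {x} x≤y n∣x-y = sym (trans (%-congˡ (sym (m+[n∸m]≡n x≤y)))
  (%-remove-+ʳ x (subst (_ ∣_) (m≤n⇒∣m-n∣≡n∸m x≤y) n∣x-y)))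

≡[mod]⇒%≡ : ∀ {x y n} .{{_ : NonZero n}} → x ≡ y [mod n ] → x % n ≡ y % n
≡[mod]⇒%≡ {x} {y} n∣x-y with ≤-total x y
... | inj₁ x≤y = ≤∧≡[mod]⇒%≡ x≤y n∣x-y
... | inj₂ y≤x = sym (≤∧≡[mod]⇒%≡ y≤x (subst (_ ∣_) (∣-∣-comm x y) n∣x-y))

+-cong-%≡ : ∀ {a b c d n} .{{_ : NonZero n}} →
  a % n ≡ b % n → c % n ≡ d % n → (a + c) % n ≡ (b + d) % n
+-cong-%≡ {a} {b} {c} {d} {n} a≡b c≡d = begin
  (a + c) % n           ≡⟨ %-distribˡ-+ a c n ⟩
  (a % n + c % n) % n   ≡⟨ cong₂ (λ u v → (u + v) % n) a≡b c≡d ⟩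
  (b % n + d % n) % n   ≡⟨ %-distribˡ-+ b d n ⟨
  (b + d) % n           ∎
  where open ≡-Reasoning

*-cong-%≡ : ∀ {a b c d n} .{{_ : NonZero n}} →
  a % n ≡ b % n → c % n ≡ d % n → (a * c) % n ≡ (b * d) % n
*-cong-%≡ {a} {b} {c} {d} {n} a≡b c≡d = begin
  (a * c) % n           ≡⟨ %-distribˡ-* a c n ⟩
  (a % n * (c % n)) % n ≡⟨ cong₂ (λ u v → (u * v) % n) a≡b c≡d ⟩
  (b % n * (d % n)) % n ≡⟨ %-distribˡ-* b d n ⟨
  (b * d) % n           ∎
  where open ≡-Reasoning

+-cancelʳ-%≡ : ∀ {a b c n} .{{_ : NonZero n}} → (a + c) % n ≡ (b + c) % n → a % n ≡ b % n
+-cancelʳ-%≡ {a} {b} {c} eq = ≡[mod]⇒%≡ (subst (_ ∣_) ∣a+c-b+c∣≡∣a-b∣ (%≡⇒≡[mod] eq))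
  where
  ∣a+c-b+c∣≡∣a-b∣ : ∣ a + c - b + c ∣ ≡ ∣ a - b ∣
  ∣a+c-b+c∣≡∣a-b∣ = trans (cong₂ ∣_-_∣ (+-comm a c) (+-comm b c)) (∣m+n-m+o∣≡∣n-o∣ c a b)

sum-cong-%≡ : ∀ {A : Set} {n} .{{_ : NonZero n}} {f g : A → ℕ} (xs : List A) →
  (∀ x → f x % n ≡ g x % n) → sum (map f xs) % n ≡ sum (map g xs) % n
sum-cong-%≡ []       f≡g = refl
sum-cong-%≡ (x ∷ xs) f≡g = +-cong-%≡ (f≡g x) (sum-cong-%≡ xs f≡g)

%≡-weaken : ∀ {x y m n} .{{_ : NonZero m}} .{{_ : NonZero n}} →
  m ∣ n → x % n ≡ y % n → x % m ≡ y % m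
%≡-weaken {x} {y} {m} {n} m∣n eq = begin
  x % m       ≡⟨ m∣n⇒o%n%m≡o%m m n x m∣n ⟨
  x % n % m   ≡⟨ cong (_% m) eq ⟩
  y % n % m   ≡⟨ m∣n⇒o%n%m≡o%m m n y m∣n ⟩
  y % m       ∎
  where open ≡-Reasoning

coprime⇒*-∣ : ∀ {m n o} → Coprime m n → m ∣ o → n ∣ o → m * n ∣ o
coprime⇒*-∣ {m} {n} cop m∣o (divides r refl) =
  *-monoˡ-∣ n (coprime-divisor cop (subst (m ∣_) (*-comm r n) m∣o))

coprime-%≡ : ∀ {x y m n} .{{_ : NonZero m}} .{{_ : NonZero n}} .{{_ : NonZero (m * n)}} →
  Coprime m n → x % m ≡ y % m → x % n ≡ y % n → x % (m * n) ≡ y % (m * n)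
coprime-%≡ cop eqₘ eqₙ = ≡[mod]⇒%≡ (coprime⇒*-∣ cop (%≡⇒≡[mod] eqₘ) (%≡⇒≡[mod] eqₙ))

∣-resp-%≡ : ∀ {d x y n} .{{_ : NonZero n}} → d ∣ n → x % n ≡ y % n → d ∣ x → d ∣ y
∣-resp-%≡ d∣n eq d∣x = ∣n∣m%n⇒∣m d∣n (subst (_ ∣_) eq (%-presˡ-∣ d∣x d∣n))

foldr-gcd∣n : ∀ {n} (xs : List ℕ) → foldr gcd n xs ∣ n
foldr-gcd∣n []       = ∣-refl
foldr-gcd∣n (x ∷ xs) = ∣-trans (gcd[m,n]∣n x _) (foldr-gcd∣n xs)

foldr-gcd∣∈ : ∀ {n x} {xs : List ℕ} → x ∈ xs → foldr gcd n xs ∣ x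
foldr-gcd∣∈ {xs = x ∷ xs} (here refl) = gcd[m,n]∣m x _
foldr-gcd∣∈ {xs = x ∷ xs} (there x∈xs) = ∣-trans (gcd[m,n]∣n x _) (foldr-gcd∣∈ x∈xs)

foldr-gcd-greatest : ∀ {d n} (xs : List ℕ) → (∀ {x} → x ∈ xs → d ∣ x) → d ∣ n → d ∣ foldr gcd n xs
foldr-gcd-greatest []       d∣xs d∣n = d∣n
foldr-gcd-greatest (x ∷ xs) d∣xs d∣n =
  gcd-greatest (d∣xs (here refl)) (foldr-gcd-greatest xs (λ x∈xs → d∣xs (there x∈xs)) d∣n)

gcdAll∣n : ∀ k (a : Tuple k) n → gcdAll k a n ∣ n
gcdAll∣n k a n = foldr-gcd∣n (map a (allFin k))

gcdAll∣ : ∀ {k} (a : Tuple k) n j → gcdAll k a n ∣ a j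
gcdAll∣ a n j = foldr-gcd∣∈ (∈-map⁺ a (∈-allFin j))

gcdAll-greatest : ∀ {k d} (a : Tuple k) n → (∀ j → d ∣ a j) → d ∣ n → d ∣ gcdAll k a n
gcdAll-greatest {k} {d} a n d∣a = foldr-gcd-greatest (map a (allFin k)) d∣a∈
  where
  d∣a∈ : ∀ {x} → x ∈ map a (allFin k) → d ∣ x
  d∣a∈ x∈ with ∈-map⁻ a x∈
  ... | j , _ , refl = d∣a j

gcdAll-cong-%≡ : ∀ {k n} .{{_ : NonZero n}} (a b : Tuple k) → (∀ j → a j % n ≡ b j % n) →
  gcdAll k a n ≡ gcdAll k b n
gcdAll-cong-%≡ {k} {n} a b a≡b =
  ∣-antisym (divides-other a b a≡b) (divides-other b a (λ j → sym (a≡b j)))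
  where
  divides-other : (u v : Tuple k) → (∀ j → u j % n ≡ v j % n) → gcdAll k u n ∣ gcdAll k v n
  divides-other u v u≡v = gcdAll-greatest v n
    (λ j → ∣-resp-%≡ (gcdAll∣n k u n) (u≡v j) (gcdAll∣ u n j)) (gcdAll∣n k u n)

gcdAll-* : ∀ {k m n} (a : Tuple k) → gcdAll k a m ≡ 1 → gcdAll k a n ≡ 1 → gcdAll k a (m * n) ≡ 1
gcdAll-* {k} {m} {n} a gₘ≡1 gₙ≡1 =
  ∣1⇒≡1 (subst (D ∣_) gₙ≡1 (gcdAll-greatest a n (gcdAll∣ a (m * n)) D∣n))
  where
  D : ℕ
  D = gcdAll k a (m * n)
  D⊥m : Coprime D m
  D⊥m = gcd≡1⇒coprime (∣1⇒≡1 (subst (gcd D m ∣_) gₘ≡1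
    (gcdAll-greatest a m (λ j → ∣-trans (gcd[m,n]∣m D m) (gcdAll∣ a (m * n) j)) (gcd[m,n]∣n D m))))
  D∣n : D ∣ n
  D∣n = coprime-divisor D⊥m (gcdAll∣n k a (m * n))

coprime⇒idempotent : ∀ {m n} .{{_ : NonZero m}} → Coprime m n → ∃ λ e → e % m ≡ 1 % m × n ∣ e
coprime⇒idempotent {m} {n} m⊥n with coprime-Bézout m⊥n
... | Bézout.-+ x y 1+xm≡yn = y * n , trans (%-congˡ (sym 1+xm≡yn)) ([m+kn]%n≡m%n 1 x m) , n∣m*n y
... | Bézout.+- x y 1+yn≡xm = e , +-cancelʳ-%≡ e+yn≡1+yn , ∣n⇒∣m*n (m ∸ 1) (n∣m*n y)
  where
  -- yn ≡ -1 (mod m), so (m - 1)·yn ≡ 1.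
  e : ℕ
  e = (m ∸ 1) * (y * n)
  e+yn≡1+yn : (e + y * n) % m ≡ (1 + y * n) % m
  e+yn≡1+yn = begin
    (e + y * n) % m               ≡⟨ %-congˡ (+-comm e (y * n)) ⟩
    (suc (m ∸ 1) * (y * n)) % m   ≡⟨ %-congˡ (cong (_* (y * n)) (suc-pred m)) ⟩
    (m * (y * n)) % m             ≡⟨ %-remove-+ʳ 0 (m∣m*n (y * n)) ⟩
    0 % m                         ≡⟨ %-remove-+ʳ 0 (n∣m*n x) ⟨
    (x * m) % m                   ≡⟨ %-congˡ 1+yn≡xm ⟨
    (1 + y * n) % m               ∎
    where open ≡-Reasoning

*-unit-%≡ : ∀ {e n} .{{_ : NonZero n}} u → e % n ≡ 1 % n → (u * e) % n ≡ u % n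
*-unit-%≡ u e≡1 = trans (*-cong-%≡ {u} refl e≡1) (%-congˡ (*-identityʳ u))

combination : ∀ {k} .{{_ : NonZero k}} → Tuple k → Tuple k → Tuple k
combination {k} λs a i = ΣFin k (λ j → λs j * circ a i j)

combination-cong-%≡ : ∀ {k n} .{{_ : NonZero k}} .{{_ : NonZero n}} {λs μs a b : Tuple k} →
  (∀ j → λs j % n ≡ μs j % n) → (∀ j → a j % n ≡ b j % n) →
  ∀ i → combination λs a i % n ≡ combination μs b i % n
combination-cong-%≡ {k} λ≡μ a≡b i =
  sum-cong-%≡ (allFin k) (λ j → *-cong-%≡ (λ≡μ j) (a≡b (subMod i j)))

InN-reduce : ∀ {k m n} .{{_ : NonZero k}} .{{_ : NonZero m}} .{{_ : NonZero n}} {a b v : Tuple k} →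
  m ∣ n → (∀ j → a j % m ≡ b j % m) → InN k n a v → InN k m b v
InN-reduce {v = v} m∣n a≡b (λs , v≡) = λs , λ i → %≡⇒≡[mod] {v i}
  (trans (%≡-weaken m∣n (≡[mod]⇒%≡ (v≡ i))) (combination-cong-%≡ {λs = λs} (λ _ → refl) a≡b i))

module ChineseRemainder {p q : ℕ} .{{_ : NonZero p}} .{{_ : NonZero q}} (p⊥q : Coprime p q) where

  private
    instance
      pq≢0 : NonZero (p * q)
      pq≢0 = m*n≢0 p q

    e₁ e₂ : ℕ
    e₁ = proj₁ (coprime⇒idempotent p⊥q)
    e₂ = proj₁ (coprime⇒idempotent (coprime-sym p⊥q))

    e₁≡1 : e₁ % p ≡ 1 % p
    e₁≡1 = proj₁ (proj₂ (coprime⇒idempotent p⊥q))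

    e₂≡1 : e₂ % q ≡ 1 % q
    e₂≡1 = proj₁ (proj₂ (coprime⇒idempotent (coprime-sym p⊥q)))

    q∣e₁ : q ∣ e₁
    q∣e₁ = proj₂ (proj₂ (coprime⇒idempotent p⊥q))

    p∣e₂ : p ∣ e₂
    p∣e₂ = proj₂ (proj₂ (coprime⇒idempotent (coprime-sym p⊥q)))

  crt : ℕ → ℕ → ℕ
  crt u w = u * e₁ + w * e₂

  crt-%ˡ : ∀ u w → crt u w % p ≡ u % p
  crt-%ˡ u w = trans (%-remove-+ʳ (u * e₁) (∣n⇒∣m*n w p∣e₂)) (*-unit-%≡ u e₁≡1)

  crt-%ʳ : ∀ u w → crt u w % q ≡ w % q
  crt-%ʳ u w = trans (%-remove-+ˡ (w * e₂) (∣n⇒∣m*n u q∣e₁)) (*-unit-%≡ w e₂≡1)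

  crt-unique : ∀ {x} u w → x % p ≡ u % p → x % q ≡ w % q → x % (p * q) ≡ crt u w % (p * q)
  crt-unique u w x≡u x≡w = coprime-%≡ p⊥q (trans x≡u (sym (crt-%ˡ u w))) (trans x≡w (sym (crt-%ʳ u w)))

  module _ {k} .{{_ : NonZero k}} (a b : Tuple k) where

    combination-crt-%ˡ : ∀ λs μs i →
      combination (zipWith crt λs μs) (zipWith crt a b) i % p ≡ combination λs a i % p
    combination-crt-%ˡ λs μs =
      combination-cong-%≡ (λ j → crt-%ˡ (λs j) (μs j)) (λ j → crt-%ˡ (a j) (b j))

    combination-crt-%ʳ : ∀ λs μs i →
      combination (zipWith crt λs μs) (zipWith crt a b) i % q ≡ combination μs b i % q
    combination-crt-%ʳ λs μs =
      combination-cong-%≡ (λ j → crt-%ʳ (λs j) (μs j)) (λ j → crt-%ʳ (a j) (b j))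

    InN-crt : ∀ {y z} → InN k p a y → InN k q b z → InN k (p * q) (zipWith crt a b) (zipWith crt y z)
    InN-crt {y} {z} (λs , y≡) (μs , z≡) = zipWith crt λs μs , λ i → %≡⇒≡[mod] {crt (y i) (z i)} (sym
      (crt-unique (y i) (z i)
        (trans (combination-crt-%ˡ λs μs i) (sym (≡[mod]⇒%≡ (y≡ i))))
        (trans (combination-crt-%ʳ λs μs i) (sym (≡[mod]⇒%≡ (z≡ i))))))

    crt-≅ : Nsub k (p * q) (zipWith crt a b) ≅ (Nsub k p a ⊗ Nsub k q b)
    crt-≅ = record
      { to        = λ x → x , x
      ; from      = λ (y , z) → zipWith crt y z
      ; to-mem    = λ x x∈ → InN-reduce {v = x} (m∣m*n q) (λ j → crt-%ˡ (a j) (b j)) x∈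
                           , InN-reduce {v = x} (n∣m*n p) (λ j → crt-%ʳ (a j) (b j)) x∈
      ; from-mem  = λ (y , z) (y∈ , z∈) → InN-crt {y} {z} y∈ z∈
      ; to-cong   = λ _ _ _ _ x≡x' → (λ i → ∣-trans (m∣m*n q) (x≡x' i))
                                   , (λ i → ∣-trans (n∣m*n p) (x≡x' i))
      ; from-cong = λ (y , z) (y' , z') _ _ (y≡y' , z≡z') i → %≡⇒≡[mod] {crt (y i) (z i)}
                      (crt-unique (y' i) (z' i)
                        (trans (crt-%ˡ (y i) (z i)) (≡[mod]⇒%≡ (y≡y' i)))
                        (trans (crt-%ʳ (y i) (z i)) (≡[mod]⇒%≡ (z≡z' i))))
      ; from-to   = λ x _ i → %≡⇒≡[mod] {crt (x i) (x i)} (sym (crt-unique (x i) (x i) refl refl))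
      ; to-from   = λ (y , z) _ → (λ i → %≡⇒≡[mod] {crt (y i) (z i)} (crt-%ˡ (y i) (z i)))
                                , (λ i → %≡⇒≡[mod] {crt (y i) (z i)} (crt-%ʳ (y i) (z i)))
      ; to-hom    = λ x x' _ _ → (λ i → ≡[mod]-refl {x i + x' i}) , (λ i → ≡[mod]-refl {x i + x' i})
      }

    crt-isAlgebraicGon : IsAlgebraicGon k p a → IsAlgebraicGon k q b →
      IsAlgebraicGon k (p * q) (zipWith crt a b)
    crt-isAlgebraicGon (Σa≡0 , gcd[a]≡1) (Σb≡0 , gcd[b]≡1) =
        %≡⇒≡[mod] {ΣFin k (zipWith crt a b)} (coprime-%≡ p⊥q
          (trans (sum-cong-%≡ (allFin k) (λ j → crt-%ˡ (a j) (b j))) (≡[mod]⇒%≡ Σa≡0))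
          (trans (sum-cong-%≡ (allFin k) (λ j → crt-%ʳ (a j) (b j))) (≡[mod]⇒%≡ Σb≡0)))
      , gcdAll-* (zipWith crt a b)
          (trans (gcdAll-cong-%≡ (zipWith crt a b) a (λ j → crt-%ˡ (a j) (b j))) gcd[a]≡1)
          (trans (gcdAll-cong-%≡ (zipWith crt a b) b (λ j → crt-%ʳ (a j) (b j))) gcd[b]≡1)

    crt-nonzero : ∀ i → ¬ (a i ≡ 0 [mod p ]) ⊎ ¬ (b i ≡ 0 [mod q ]) →
      ¬ (zipWith crt a b i ≡ 0 [mod p * q ])
    crt-nonzero i (inj₁ aᵢ≢0) cᵢ≡0 = aᵢ≢0 (%≡⇒≡[mod] {a i} {0}
      (trans (sym (crt-%ˡ (a i) (b i))) (≡[mod]⇒%≡ (∣-trans (m∣m*n q) cᵢ≡0))))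
    crt-nonzero i (inj₂ bᵢ≢0) cᵢ≡0 = bᵢ≢0 (%≡⇒≡[mod] {b i} {0}
      (trans (sym (crt-%ʳ (a i) (b i))) (≡[mod]⇒%≡ (∣-trans (n∣m*n p) cᵢ≡0))))

proposition3 : (k : ℕ) .{{_ : NonZero k}} → 2 ≤ k →
    (n₁ n₂ : ℕ) → 1 ≤ n₁ → 1 ≤ n₂ → Coprime n₁ n₂ →
    (a b : Tuple k) → IsAlgebraicGon k n₁ a → IsAlgebraicGon k n₂ b →
    ∃ λ (c : Tuple k) →
      IsAlgebraicGon k (n₁ * n₂) c
      × (Nsub k (n₁ * n₂) c ≅ (Nsub k n₁ a ⊗ Nsub k n₂ b))
      × ((∀ i → (¬ (a i ≡ 0 [mod n₁ ])) ⊎ (¬ (b i ≡ 0 [mod n₂ ])))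
         → ∀ i → ¬ (c i ≡ 0 [mod n₁ * n₂ ]))
proposition3 k _ n₁ n₂ 0<n₁ 0<n₂ n₁⊥n₂ a b a-gon b-gon =
    zipWith crt a b
  , crt-isAlgebraicGon a b a-gon b-gon
  , crt-≅ a b
  , λ a∨b≢0 i → crt-nonzero a b i (a∨b≢0 i)
  where
  instance
    n₁≢0 : NonZero n₁
    n₁≢0 = >-nonZero 0<n₁
    n₂≢0 : NonZero n₂
    n₂≢0 = >-nonZero 0<n₂
  open ChineseRemainder n₁⊥n₂
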